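{- For every integer $n\geq 2$ we have $C_{\{1\},\{1\}}(n)=n^2$.
   Context: $\mathbb Z_n=\mathbb Z/n\mathbb Z$ as a module over itself. For non-empty $A,B\subseteq\mathbb Z_n$, a sequence $(x_1,\ldots,x_k)$ in $\mathbb Z_n$ is an $(A,B)$-weighted zero-sum sequence if there exist $a_i\in A$, $b_i\in B$ with $\sum a_ix_i=0$ and $\sum b_ia_i=0$. $C_{A,B}(n)$ is the least positive integer $k$ such that every sequence in $\mathbb Z_n$ of length $k$ has an $(A,B)$-weighted zero-sum subsequence having consecutive terms, i.e. a non-empty block $(x_i,x_{i+1},\ldots,x_j)$. -}

module Defs where

open import Data.Nat using (ℕ; _*_; _+_; _≤_)
open import Data.Nat.Divisibility using (_∣_)
open import Data.Fin using (Fin; toℕ)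
open import Data.List using (List; []; _∷_; _++_; length; zipWith)
open import Data.Nat.ListAction using (sum)
open import Data.List.Relation.Unary.All using (All)
open import Data.Product using (Σ; _×_)
open import Relation.Binary.PropositionalEquality using (_≡_; _≢_)

-- Elements of ℤ_n are represented by Fin n (residues 0..n-1); a relation
-- "u = 0 in ℤ_n" for a natural-number representative u is  n ∣ u.

dot : {n : ℕ} → List (Fin n) → List (Fin n) → ℕ
dot cs xs = sum (zipWith (λ c x → toℕ c * toℕ x) cs xs)

WeightedZeroSum : (n : ℕ) (A B : Fin n → Set) → List (Fin n) → Set
WeightedZeroSum n A B xs =
  Σ (List (Fin n)) λ as → Σ (List (Fin n)) λ bs →
    length as ≡ length xs × length bs ≡ length xs ×
    All A as × All B bs ×
    n ∣ dot as xs × n ∣ dot bs as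

HasWZSBlock : (n : ℕ) (A B : Fin n → Set) → List (Fin n) → Set
HasWZSBlock n A B xs =
  Σ (List (Fin n)) λ pre → Σ (List (Fin n)) λ blk → Σ (List (Fin n)) λ post →
    xs ≡ pre ++ blk ++ post × blk ≢ [] × WeightedZeroSum n A B blk

Property : (n : ℕ) (A B : Fin n → Set) → ℕ → Set
Property n A B k = (xs : List (Fin n)) → length xs ≡ k → HasWZSBlock n A B xs

IsC : (n : ℕ) (A B : Fin n → Set) → ℕ → Set
IsC n A B c = 1 ≤ c × Property n A B c × ((k : ℕ) → 1 ≤ k → Property n A B k → c ≤ k)

One : {n : ℕ} → Fin n → Set
One a = toℕ a ≡ 1

-- With all weights equal to 1, a block is a weighted zero-sum block exactly
-- when it is balanced: both its length and its sum vanish modulo n.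
-- Upper bound: in a sequence of length n², the n + 1 prefixes of lengths
-- 0, n, 2n, …, n² have two sums congruent modulo n, and the block between
-- them is balanced.
-- Lower bound: in the periodic sequence 1 0 … 0 1 0 … 0 … (period n), a block
-- of length qn has sum q; in a sequence shorter than n² we have 0 < q < n,
-- so n ∤ q.
module Submission where

open import Defs
open import Data.Nat using (ℕ; zero; suc; _+_; _*_; _∸_; _≤_; _<_; _⊓_; z≤n; s≤s; s≤s⁻¹; NonZero)
open import Data.Nat.Properties
open import Data.Nat.Divisibility using (_∣_; divides; ∣⇒≤; ∣m+n∣m⇒∣n)
open import Data.Nat.DivMod using (_%_; _/_; _mod_; m≡m%n+[m/n]*n)
open import Data.Fin as Fin using (Fin; toℕ)
open import Data.Fin.Properties using (toℕ-fromℕ<; pigeonhole; toℕ<n)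
open import Data.List using (List; []; _∷_; _++_; length; map; replicate; take; drop)
open import Data.List.Properties
  using (map-++; ++-assoc; length-++; length-replicate; take-take; take++drop≡id; length-take; length-drop; ∷-injective; ∷-injectiveʳ)
open import Data.List.Relation.Unary.All using (All; []; _∷_)
open import Data.List.Relation.Unary.All.Properties using (replicate⁺)
open import Data.Nat.ListAction using (sum)
open import Data.Nat.ListAction.Properties using (sum-++)
open import Data.Product using (Σ; _×_; _,_)
open import Relation.Nullary using (¬_; contradiction)
open import Function using (_∘_)
open import Relation.Binary.PropositionalEquality

[m+k]%n≡m%n⇒n∣k : ∀ m k {n} .{{_ : NonZero n}} → (m + k) % n ≡ m % n → n ∣ k
[m+k]%n≡m%n⇒n∣k m k {n} eq = ∣m+n∣m⇒∣n (divides ((m + k) / n) shifted) (divides (m / n) refl)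
  where
  open ≡-Reasoning
  shifted : m / n * n + k ≡ (m + k) / n * n
  shifted = +-cancelˡ-≡ (m % n) _ _ (begin
    m % n + (m / n * n + k)        ≡⟨ +-assoc (m % n) _ k ⟨
    m % n + m / n * n + k          ≡⟨ cong (_+ k) (m≡m%n+[m/n]*n m n) ⟨
    m + k                          ≡⟨ m≡m%n+[m/n]*n (m + k) n ⟩
    (m + k) % n + (m + k) / n * n  ≡⟨ cong (_+ (m + k) / n * n) eq ⟩
    m % n + (m + k) / n * n        ∎)

n∣m∧m<n⇒m≡0 : ∀ {n m} → n ∣ m → m < n → m ≡ 0
n∣m∧m<n⇒m≡0 {m = zero}  _   _   = refl
n∣m∧m<n⇒m≡0 {m = suc _} n∣m m<n = contradiction (∣⇒≤ n∣m) (<⇒≱ m<n)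

mod≡⇒%≡ : ∀ m k {n} .{{_ : NonZero n}} → m mod n ≡ k mod n → m % n ≡ k % n
mod≡⇒%≡ m k eq = trans (sym (toℕ-fromℕ< _)) (trans (cong toℕ eq) (toℕ-fromℕ< _))

module _ {A : Set} where

  HasBlock : (List A → Set) → List A → Set
  HasBlock P xs = Σ (List A) λ pre → Σ (List A) λ blk → Σ (List A) λ post →
    xs ≡ pre ++ blk ++ post × blk ≢ [] × P blk

  HasBlock-map : {P Q : List A → Set} → (∀ {ys} → P ys → Q ys) →
                 ∀ {xs} → HasBlock P xs → HasBlock Q xs
  HasBlock-map f (pre , blk , post , split , nonempty , p) = pre , blk , post , split , nonempty , f p

  length-infix : ∀ {xs : List A} pre blk post → xs ≡ pre ++ blk ++ post → length blk ≤ length xs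
  length-infix pre blk post refl = begin
    length blk                               ≤⟨ m≤n+m (length blk) (length pre) ⟩
    length pre + length blk                  ≤⟨ +-monoʳ-≤ (length pre) (m≤m+n (length blk) (length post)) ⟩
    length pre + (length blk + length post)  ≡⟨ cong (length pre +_) (length-++ blk) ⟨
    length pre + length (blk ++ post)        ≡⟨ length-++ pre ⟨
    length (pre ++ blk ++ post)              ∎
    where open ≤-Reasoning

  length≡0⇒[] : ∀ {xs : List A} → length xs ≡ 0 → xs ≡ []
  length≡0⇒[] {[]} _ = refl

  segment : ℕ → ℕ → List A → List A
  segment a b xs = drop a (take b xs)

  take++segment : ∀ {a b} (xs : List A) → a ≤ b → take a xs ++ segment a b xs ≡ take b xs
  take++segment {a} {b} xs a≤b = begin
    take a xs ++ drop a (take b xs)           ≡⟨ cong (_++ drop a (take b xs)) take-a-take-b ⟨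
    take a (take b xs) ++ drop a (take b xs)  ≡⟨ take++drop≡id a (take b xs) ⟩
    take b xs                                 ∎
    where
    open ≡-Reasoning
    take-a-take-b : take a (take b xs) ≡ take a xs
    take-a-take-b = trans (take-take a b xs) (cong (λ t → take t xs) (m≤n⇒m⊓n≡m a≤b))

  split-at-segment : ∀ {a b} (xs : List A) → a ≤ b → xs ≡ take a xs ++ segment a b xs ++ drop b xs
  split-at-segment {a} {b} xs a≤b = sym (begin
    take a xs ++ segment a b xs ++ drop b xs    ≡⟨ ++-assoc (take a xs) _ _ ⟨
    (take a xs ++ segment a b xs) ++ drop b xs  ≡⟨ cong (_++ drop b xs) (take++segment xs a≤b) ⟩
    take b xs ++ drop b xs                      ≡⟨ take++drop≡id b xs ⟩
    xs                                          ∎)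
    where open ≡-Reasoning

  length-segment : ∀ a {b} (xs : List A) → b ≤ length xs → length (segment a b xs) ≡ b ∸ a
  length-segment a {b} xs b≤len = begin
    length (drop a (take b xs))  ≡⟨ length-drop a (take b xs) ⟩
    length (take b xs) ∸ a       ≡⟨ cong (_∸ a) (length-take b xs) ⟩
    b ⊓ length xs ∸ a            ≡⟨ cong (_∸ a) (m≤n⇒m⊓n≡m b≤len) ⟩
    b ∸ a                        ∎
    where open ≡-Reasoning

residueSum : {n : ℕ} → List (Fin n) → ℕ
residueSum xs = sum (map toℕ xs)

residueSum-++ : {n : ℕ} (xs ys : List (Fin n)) → residueSum (xs ++ ys) ≡ residueSum xs + residueSum ys
residueSum-++ xs ys = trans (cong sum (map-++ toℕ xs ys)) (sum-++ (map toℕ xs) (map toℕ ys))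

Balanced : (n : ℕ) → List (Fin n) → Set
Balanced n ys = n ∣ length ys × n ∣ residueSum ys

dot-ones : {n : ℕ} (cs ys : List (Fin n)) → All One cs → length cs ≡ length ys → dot cs ys ≡ residueSum ys
dot-ones []       []       _        _  = refl
dot-ones (c ∷ cs) (y ∷ ys) (c≡1 ∷ ones) eq rewrite c≡1 =
  cong₂ _+_ (+-identityʳ (toℕ y)) (dot-ones cs ys ones (suc-injective eq))

residueSum-ones : {n : ℕ} (cs : List (Fin n)) → All One cs → residueSum cs ≡ length cs
residueSum-ones []       []            = refl
residueSum-ones (c ∷ cs) (c≡1 ∷ ones) rewrite c≡1 = cong suc (residueSum-ones cs ones)

weightedZeroSum⇒balanced : ∀ {n} {xs : List (Fin n)} → WeightedZeroSum n One One xs → Balanced n xs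
weightedZeroSum⇒balanced {n} {xs} (as , bs , las , lbs , ones-as , ones-bs , n∣ax , n∣ba) =
    subst (n ∣_) (trans (dot-ones bs as ones-bs (trans lbs (sym las)))
                        (trans (residueSum-ones as ones-as) las)) n∣ba
  , subst (n ∣_) (dot-ones as xs ones-as las) n∣ax

balanced⇒weightedZeroSum : ∀ {d} {xs : List (Fin (suc (suc d)))} →
                           Balanced (suc (suc d)) xs → WeightedZeroSum (suc (suc d)) One One xs
balanced⇒weightedZeroSum {d} {xs} (n∣len , n∣sum) =
  ones , ones , length-ones , length-ones , ones-One , ones-One , n∣ax , n∣aa
  where
  n = suc (suc d)
  ones : List (Fin n)
  ones = replicate (length xs) (Fin.suc Fin.zero)
  ones-One : All One ones
  ones-One = replicate⁺ (length xs) refl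
  length-ones : length ones ≡ length xs
  length-ones = length-replicate (length xs)
  n∣ax : n ∣ dot ones xs
  n∣ax = subst (n ∣_) (sym (dot-ones ones xs ones-One length-ones)) n∣sum
  n∣aa : n ∣ dot ones ones
  n∣aa = subst (n ∣_) (sym (trans (dot-ones ones ones ones-One refl)
                                  (trans (residueSum-ones ones ones-One) length-ones))) n∣len

balancedBlock : ∀ {n} .{{_ : NonZero n}} (xs : List (Fin n)) → n * n ≤ length xs → HasBlock (Balanced n) xs
balancedBlock {n} xs n²≤len
  with i , j , i<j , same ← pigeonhole (n<1+n n) (λ t → residueSum (take (toℕ t * n) xs) mod n)
  = take a xs , blk , drop b xs , split-at-segment xs a≤b , nonempty , divides (toℕ j ∸ toℕ i) length-blk , n∣sum
  where
  open ≡-Reasoning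
  a b : ℕ
  a = toℕ i * n
  b = toℕ j * n
  blk : List (Fin n)
  blk = segment a b xs
  a≤b : a ≤ b
  a≤b = *-monoˡ-≤ n (<⇒≤ i<j)
  length-blk : length blk ≡ (toℕ j ∸ toℕ i) * n
  length-blk = begin
    length blk          ≡⟨ length-segment a xs (≤-trans (*-monoˡ-≤ n (s≤s⁻¹ (toℕ<n j))) n²≤len) ⟩
    b ∸ a               ≡⟨ *-distribʳ-∸ n (toℕ j) (toℕ i) ⟨
    (toℕ j ∸ toℕ i) * n ∎
  nonempty : blk ≢ []
  nonempty blk≡[] = <⇒≱ i<j (m∸n≡0⇒m≤n (m*n≡0⇒m≡0 _ n (trans (sym length-blk) (cong length blk≡[]))))
  n∣sum : n ∣ residueSum blk
  n∣sum = [m+k]%n≡m%n⇒n∣k (residueSum (take a xs)) (residueSum blk) (begin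
    (residueSum (take a xs) + residueSum blk) % n  ≡⟨ cong (_% n) (residueSum-++ (take a xs) blk) ⟨
    residueSum (take a xs ++ blk) % n              ≡⟨ cong (λ ys → residueSum ys % n) (take++segment xs a≤b) ⟩
    residueSum (take b xs) % n                     ≡⟨ mod≡⇒%≡ (residueSum (take a xs)) _ same ⟨
    residueSum (take a xs) % n                     ∎)

module Ticks (d : ℕ) where

  n D : ℕ
  n = suc (suc d)
  D = suc d

  -- For r < n, ticks r k has length k, with ones at the positions ≡ r (mod n)
  -- and zeros elsewhere.
  ticks : ℕ → ℕ → List (Fin n)
  ticks r       zero    = []
  ticks zero    (suc k) = Fin.suc Fin.zero ∷ ticks D k
  ticks (suc r) (suc k) = Fin.zero ∷ ticks r k

  length-ticks : ∀ r k → length (ticks r k) ≡ k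
  length-ticks r       zero    = refl
  length-ticks zero    (suc k) = cong suc (length-ticks D k)
  length-ticks (suc r) (suc k) = cong suc (length-ticks r k)

  ticks-suffix : ∀ {r} k pre {rest} → r ≤ D → ticks r k ≡ pre ++ rest →
                 Σ ℕ λ r′ → r′ ≤ D × rest ≡ ticks r′ (length rest)
  ticks-suffix {r} k [] r≤D refl = r , r≤D , cong (ticks r) (sym (length-ticks r k))
  ticks-suffix {zero}  (suc k) (_ ∷ pre) _   eq = ticks-suffix k pre ≤-refl (∷-injectiveʳ eq)
  ticks-suffix {suc r} (suc k) (_ ∷ pre) r≤D eq = ticks-suffix k pre (≤-trans (n≤1+n r) r≤D) (∷-injectiveʳ eq)

  ticks-prefix : ∀ r k blk {post} → ticks r k ≡ blk ++ post → blk ≡ ticks r (length blk)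
  ticks-prefix r       k       []        eq = refl
  ticks-prefix zero    (suc k) (_ ∷ blk) eq with refl , eq′ ← ∷-injective eq = cong (_ ∷_) (ticks-prefix D k blk eq′)
  ticks-prefix (suc r) (suc k) (_ ∷ blk) eq with refl , eq′ ← ∷-injective eq = cong (_ ∷_) (ticks-prefix r k blk eq′)

  ticks-infix : ∀ {r k} pre blk post → r ≤ D → ticks r k ≡ pre ++ blk ++ post →
                Σ ℕ λ r′ → r′ ≤ D × blk ≡ ticks r′ (length blk)
  ticks-infix {k = k} pre blk post r≤D eq
    with r′ , r′≤D , rest≡ ← ticks-suffix k pre r≤D eq
    = r′ , r′≤D , ticks-prefix r′ (length (blk ++ post)) blk (sym rest≡)

  residueSum-zeros++ : ∀ e (ys : List (Fin n)) → residueSum (replicate e Fin.zero ++ ys) ≡ residueSum ys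
  residueSum-zeros++ zero    ys = refl
  residueSum-zeros++ (suc e) ys = residueSum-zeros++ e ys

  ticks-until-tick : ∀ r j → ticks r (suc r + j) ≡ replicate r Fin.zero ++ Fin.suc Fin.zero ∷ ticks D j
  ticks-until-tick zero    j = refl
  ticks-until-tick (suc r) j = cong (Fin.zero ∷_) (ticks-until-tick r j)

  ticks-delay : ∀ e r L → ticks (e + r) (e + L) ≡ replicate e Fin.zero ++ ticks r L
  ticks-delay zero    r L       = refl
  ticks-delay (suc e) r zero    = cong (Fin.zero ∷_) (ticks-delay e r zero)
  ticks-delay (suc e) r (suc L) = cong (Fin.zero ∷_) (ticks-delay e r (suc L))

  residueSum-ticks-n+ : ∀ {r} L → r ≤ D → residueSum (ticks r (n + L)) ≡ suc (residueSum (ticks r L))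
  residueSum-ticks-n+ {r} L r≤D = begin
    residueSum (ticks r (n + L))                   ≡⟨ cong (residueSum ∘ ticks r) n+L≡ ⟩
    residueSum (ticks r (suc r + (e + L)))         ≡⟨ cong residueSum (ticks-until-tick r (e + L)) ⟩
    residueSum (replicate r Fin.zero ++ Fin.suc Fin.zero ∷ ticks D (e + L))
                                                   ≡⟨ residueSum-zeros++ r _ ⟩
    suc (residueSum (ticks D (e + L)))             ≡⟨ cong (λ t → suc (residueSum (ticks t (e + L)))) D≡e+r ⟩
    suc (residueSum (ticks (e + r) (e + L)))       ≡⟨ cong (suc ∘ residueSum) (ticks-delay e r L) ⟩
    suc (residueSum (replicate e Fin.zero ++ ticks r L))  ≡⟨ cong suc (residueSum-zeros++ e _) ⟩
    suc (residueSum (ticks r L))                   ∎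
    where
    open ≡-Reasoning
    e : ℕ
    e = D ∸ r
    D≡e+r : D ≡ e + r
    D≡e+r = sym (m∸n+n≡m r≤D)
    n+L≡ : n + L ≡ suc r + (e + L)
    n+L≡ = cong suc (trans (cong (_+ L) (trans D≡e+r (+-comm e r))) (+-assoc r e L))

  residueSum-ticks-*n : ∀ {r} q → r ≤ D → residueSum (ticks r (q * n)) ≡ q
  residueSum-ticks-*n zero    _   = refl
  residueSum-ticks-*n (suc q) r≤D = trans (residueSum-ticks-n+ (q * n) r≤D) (cong suc (residueSum-ticks-*n q r≤D))

  ticks-unbalanced : ∀ {k} → k < n * n → ¬ HasBlock (Balanced n) (ticks D k)
  ticks-unbalanced {k} k<n² (pre , blk , post , split , nonempty , divides q length≡ , n∣sum)
    with r′ , r′≤D , blk≡ ← ticks-infix pre blk post ≤-refl split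
    = nonempty (length≡0⇒[] (trans length≡ (cong (_* n) (n∣m∧m<n⇒m≡0 n∣q q<n))))
    where
    n∣q : n ∣ q
    n∣q = subst (n ∣_) (trans (cong residueSum (trans blk≡ (cong (ticks r′) length≡)))
                              (residueSum-ticks-*n q r′≤D)) n∣sum
    q*n<n*n : q * n < n * n
    q*n<n*n = begin-strict
      q * n               ≡⟨ length≡ ⟨
      length blk          ≤⟨ length-infix pre blk post split ⟩
      length (ticks D k)  ≡⟨ length-ticks D k ⟩
      k                   <⟨ k<n² ⟩
      n * n               ∎
      where open ≤-Reasoning
    q<n : q < n
    q<n = *-cancelʳ-< n q n q*n<n*n

theorem4 : (n : ℕ) → 2 ≤ n → IsC n One One (n * n)
theorem4 (suc zero) (s≤s ())
theorem4 (suc (suc d)) _ = s≤s z≤n , upper , lower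
  where
  open Ticks d
  upper : Property n One One (n * n)
  upper xs length≡ = HasBlock-map balanced⇒weightedZeroSum (balancedBlock xs (≤-reflexive (sym length≡)))
  lower : (k : ℕ) → 1 ≤ k → Property n One One k → n * n ≤ k
  lower k _ property = ≮⇒≥ λ k<n² →
    ticks-unbalanced k<n² (HasBlock-map weightedZeroSum⇒balanced (property (ticks D k) (length-ticks D k)))
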